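{- Let ${\cal A}_1,\ldots,{\cal A}_n\in\mathcal P^*\mathcal P(\mathbb N)$ have the joint intersection property, and for each $i$ let $S_i$ be a sight on ${\cal A}_i$. Then there is a coded sequence $d$ such that $d\in\mathrm{Tr}(S_i)$ for every $i$, and $d$ is a good leaf of some $S_i$.
   Context: ${\cal A}_1,\ldots,{\cal A}_n$ (nonempty families of subsets of $\mathbb N$) have the joint intersection property if $A_1\cap\cdots\cap A_n\ne\emptyset$ for all $A_1\in{\cal A}_1,\ldots,A_n\in{\cal A}_n$. A sight is, inductively, either NIL, or a pair $(A,\sigma)$ with $A\subseteq\mathbb N$ and $\sigma$ a function on $A$ whose values are sights. A sight is on ${\cal A}$ if, inductively, it is NIL, or it is $(A,\sigma)$ with $A\in{\cal A}$ and every $\sigma(a)$ on ${\cal A}$. $\langle\ldots\rangle$ codes finite sequences, $\ast$ is concatenation. The tree $\mathrm{Tr}(S)$ with its good leaves: for NIL, $\{\langle\rangle\}$ with $\langle\rangle$ a good leaf; for $(\emptyset,\emptyset)$, $\{\langle\rangle\}$ with no good leaf; for $(A,\sigma)$, $A\ne\emptyset$, $\{\langle\rangle\}\cup\{\langle a\rangle\ast t\mid a\in A,t\in\mathrm{Tr}(\sigma(a))\}$, where $\langle a\rangle\ast t$ is a good leaf iff $t$ is a good leaf of $\mathrm{Tr}(\sigma(a))$. -}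

module Defs where

open import Level using (0ℓ)
open import Data.Nat using (ℕ)
open import Data.Fin using (Fin)
open import Data.List using (List; []; _∷_)
open import Data.Product using (Σ; ∃; _×_)
open import Relation.Unary using (Pred; _∈_)

Subset : Set₁
Subset = Pred ℕ 0ℓ

Family : Set₁
Family = Pred Subset 0ℓ

NonemptyFamily : Family → Set₁
NonemptyFamily 𝒜 = Σ Subset (λ A → A ∈ 𝒜)

JointIntersection : {m : ℕ} → (Fin m → Family) → Set₁
JointIntersection {m} 𝒜 =
  (A : Fin m → Subset) → (∀ i → A i ∈ 𝒜 i) → ∃ λ k → ∀ i → k ∈ A i

data Sight : Set₁ where
  nil  : Sight
  node : (A : Subset) → ((a : ℕ) → a ∈ A → Sight) → Sight

data SightOn (𝒜 : Family) : Sight → Set₁ where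
  nil-on  : SightOn 𝒜 nil
  node-on : {A : Subset} {σ : (a : ℕ) → a ∈ A → Sight} →
            A ∈ 𝒜 → ((a : ℕ) (h : a ∈ A) → SightOn 𝒜 (σ a h)) →
            SightOn 𝒜 (node A σ)

-- Coded finite sequences are lists of naturals; ⟨a⟩ ∗ t is a ∷ t.
-- Membership in the tree Tr(S).
data InTr : Sight → List ℕ → Set₁ where
  root : {S : Sight} → InTr S []
  step : {A : Subset} {σ : (a : ℕ) → a ∈ A → Sight} {a : ℕ} {t : List ℕ} →
         (h : a ∈ A) → InTr (σ a h) t → InTr (node A σ) (a ∷ t)

data GoodLeaf : Sight → List ℕ → Set₁ where
  nil-good  : GoodLeaf nil []
  step-good : {A : Subset} {σ : (a : ℕ) → a ∈ A → Sight} {a : ℕ} {t : List ℕ} →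
              (h : a ∈ A) → GoodLeaf (σ a h) t → GoodLeaf (node A σ) (a ∷ t)

module Submission where

open import Defs
open import Data.Nat using (ℕ; suc)
open import Data.Fin using (Fin; zero; suc)
open import Data.List using (List; []; _∷_)
open import Data.Product using (∃; _×_; _,_)
open import Data.Sum using (_⊎_; inj₁; inj₂)
open import Relation.Binary.PropositionalEquality using (_≡_; refl; sym; subst)
open import Relation.Unary using (_∈_)

-- Walk down all the sights simultaneously.  As long as none of them is NIL,
-- their current root sets are members of 𝒜₀,…,𝒜ₙ, so by the joint
-- intersection property they share an element k, and we descend along k in
-- every sight at once.  The walk is well founded because it descends in the
-- (well-founded) sight S₀, so it stops at a stage where some Sᵢ is NIL: the
-- sequence walked so far is then a good leaf of that Sᵢ and lies in every tree.

Branch : {m : ℕ} → (Fin m → Sight) → Set₁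
Branch S = ∃ λ (d : List ℕ) → (∀ i → InTr (S i) d) × ∃ λ i → GoodLeaf (S i) d

record NodeOn (𝒜 : Family) (S : Sight) : Set₁ where
  field
    dom      : Subset
    dom∈𝒜    : dom ∈ 𝒜
    child    : (a : ℕ) → a ∈ dom → Sight
    child-on : (a : ℕ) (h : a ∈ dom) → SightOn 𝒜 (child a h)
    is-node  : S ≡ node dom child

open NodeOn

nil-or-node : {𝒜 : Family} {S : Sight} → SightOn 𝒜 S → GoodLeaf S [] ⊎ NodeOn 𝒜 S
nil-or-node nil-on = inj₁ nil-good
nil-or-node (node-on A∈𝒜 σ-on) = inj₂ record
  { dom∈𝒜 = A∈𝒜 ; child-on = σ-on ; is-node = refl }

some-nil-or-all-nodes : {m : ℕ} {𝒜 : Fin m → Family} {S : Fin m → Sight} →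
  (∀ i → SightOn (𝒜 i) (S i)) →
  (∃ λ i → GoodLeaf (S i) []) ⊎ (∀ i → NodeOn (𝒜 i) (S i))
some-nil-or-all-nodes {ℕ.zero} S-on = inj₂ λ ()
some-nil-or-all-nodes {suc m} S-on with nil-or-node (S-on zero)
... | inj₁ leaf = inj₁ (zero , leaf)
... | inj₂ N₀ with some-nil-or-all-nodes (λ i → S-on (suc i))
...   | inj₁ (i , leaf) = inj₁ (suc i , leaf)
...   | inj₂ N = inj₂ λ { zero → N₀ ; (suc i) → N i }

module _ {𝒜 : Family} {S : Sight} (N : NodeOn 𝒜 S) {a : ℕ} (h : a ∈ dom N) {t : List ℕ} where

  InTr-child : InTr (child N a h) t → InTr S (a ∷ t)
  InTr-child p = subst (λ T → InTr T (a ∷ t)) (sym (is-node N)) (step h p)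

  GoodLeaf-child : GoodLeaf (child N a h) t → GoodLeaf S (a ∷ t)
  GoodLeaf-child p = subst (λ T → GoodLeaf T (a ∷ t)) (sym (is-node N)) (step-good h p)

Branch-children : {m : ℕ} {𝒜 : Fin m → Family} {S : Fin m → Sight}
  (N : ∀ i → NodeOn (𝒜 i) (S i)) {k : ℕ} (k∈ : ∀ i → k ∈ dom (N i)) →
  Branch (λ i → child (N i) k (k∈ i)) → Branch S
Branch-children N {k} k∈ (d , inTr , i , leaf) =
  k ∷ d , (λ j → InTr-child (N j) (k∈ j) (inTr j)) , i , GoodLeaf-child (N i) (k∈ i) leaf

-- S₀ is passed again as T so that the recursion is structural in its SightOn derivation.
common-branch : {m : ℕ} (𝒜 : Fin (suc m) → Family) → JointIntersection 𝒜 →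
  {T : Sight} → SightOn (𝒜 zero) T →
  (S : Fin (suc m) → Sight) → S zero ≡ T → (∀ i → SightOn (𝒜 (suc i)) (S (suc i))) →
  Branch S
common-branch 𝒜 ji nil-on S S₀≡nil S-on =
  [] , (λ _ → root) , zero , subst (λ T → GoodLeaf T []) (sym S₀≡nil) nil-good
common-branch 𝒜 ji (node-on A∈𝒜 σ-on) S S₀≡node S-on
  with some-nil-or-all-nodes S-on
... | inj₁ (i , leaf) = [] , (λ _ → root) , suc i , leaf
... | inj₂ N-tail =
  let k , k∈ = ji (λ i → dom (N i)) (λ i → dom∈𝒜 (N i))
  in Branch-children N k∈
       (common-branch 𝒜 ji (σ-on k (k∈ zero)) (λ i → child (N i) k (k∈ i)) refl
         (λ i → child-on (N (suc i)) k (k∈ (suc i))))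
  where
  N : ∀ i → NodeOn (𝒜 i) (S i)
  N zero = record { dom∈𝒜 = A∈𝒜 ; child-on = σ-on ; is-node = S₀≡node }
  N (suc i) = N-tail i

proposition4p13 : (n : ℕ) (𝒜 : Fin (suc n) → Family) →
    (∀ i → NonemptyFamily (𝒜 i)) →
    JointIntersection 𝒜 →
    (S : Fin (suc n) → Sight) → (∀ i → SightOn (𝒜 i) (S i)) →
    ∃ λ (d : List ℕ) → (∀ i → InTr (S i) d) × ∃ λ i → GoodLeaf (S i) d
proposition4p13 n 𝒜 _ ji S S-on = common-branch 𝒜 ji (S-on zero) S refl (λ i → S-on (suc i))
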